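{- Let $\mathcal O_{ -3,-19}=\mathbb Z\oplus\mathbb Z\omega_1\oplus\mathbb Z\omega_2\oplus\mathbb Z\omega_3\subset\mathcal H_{ -3,-19}$ with $\omega_1=\frac{1+j}2$, $\omega_2=\frac{i+ij}2$, $\omega_3=\frac{4j+ij}{19}$. There is no congruence pair $(m,H)$ of $\mathcal O_{ -3,-19}$ with $m$ an odd prime.
   Context: $\mathcal H_{ -3,-19}$ is the quaternion algebra over $\mathbb Q$ with basis $1,i,j,ij$, $i^2=-3$, $j^2=-19$, $ij=-ji$; $\mathcal O_{ -3,-19}$ is a maximal order. For a commutative ring $A$, $\mathcal G(A)=(\mathcal O_{ -3,-19}\otimes A)^\times/A^\times$. $\phi_m:\mathcal G(\mathbb Z)\to\mathcal G(\mathbb Z/m\mathbb Z)$ is induced by reducing coordinates with respect to $1,\omega_1,\omega_2,\omega_3$ modulo $m$. A congruence pair is $(m,H)$, $m$ a positive integer, $H\le\mathcal G(\mathbb Z/m\mathbb Z)$, such that $\phi_m$ is injective on $\mathcal G(\mathbb Z)$, $H\cap\phi_m(\mathcal G(\mathbb Z))=\{1\}$ and $\phi_m(\mathcal G(\mathbb Z))\cdot H=\mathcal G(\mathbb Z/m\mathbb Z)$. -}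

module Defs where

open import Data.Nat as ℕ using (ℕ)
open import Data.Nat.Primality using (Prime)
open import Data.Nat.Divisibility as ℕD using ()
open import Data.Integer using (ℤ; +_; -_; _+_; _-_; _*_)
open import Data.Integer.Divisibility using () renaming (_∣_ to _∣ℤ_)
open import Data.Product using (Σ; Σ-syntax; ∃; ∃-syntax; _×_; _,_)
open import Data.Sum using (_⊎_)
open import Relation.Binary.PropositionalEquality using (_≡_)
open import Relation.Nullary using (¬_)
open import Level using (0ℓ)
open import Relation.Unary using (Pred)

-- Elements of O_{-3,-19} ⊗ A written in coordinates with respect to the
-- Z-basis 1, ω₁ = (1+j)/2, ω₂ = (i+ij)/2, ω₃ = (4j+ij)/19.
-- We take integer coordinates; elements of O ⊗ Z/mZ are integer
-- coordinate vectors considered modulo m (see _≈[_]_ below).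
record Quat : Set where
  constructor ⟨_,_,_,_⟩
  field
    c0 c1 c2 c3 : ℤ
open Quat public

-- Multiplication in O_{-3,-19}, using the structure constants of the basis
-- 1, ω₁, ω₂, ω₃ (computed from i² = -3, j² = -19, ij = -ji).
infixl 7 _·_
_·_ : Quat → Quat → Quat
⟨ x0 , x1 , x2 , x3 ⟩ · ⟨ y0 , y1 , y2 , y3 ⟩ = ⟨ z0 , z1 , z2 , z3 ⟩
  where
  z0 = (+ 1) * x0 * y0 + (- (+ 5)) * x1 * y1 + (- (+ 20)) * x1 * y2 + (- (+ 4)) * x1 * y3 + (+ 20) * x2 * y1 + (- (+ 15)) * x2 * y2 + (+ 7) * x2 * y3 + (- (+ 10)) * x3 * y2 + (- (+ 1)) * x3 * y3
  z1 = (+ 1) * x0 * y1 + (+ 1) * x1 * y0 + (+ 1) * x1 * y1 + (+ 40) * x1 * y2 + (+ 4) * x1 * y3 + (- (+ 40)) * x2 * y1 + (- (+ 17)) * x2 * y3 + (- (+ 4)) * x3 * y1 + (+ 17) * x3 * y2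
  z2 = (+ 1) * x0 * y2 + (+ 10) * x1 * y2 + (+ 1) * x1 * y3 + (+ 1) * x2 * y0 + (- (+ 9)) * x2 * y1 + (- (+ 4)) * x2 * y3 + (- (+ 1)) * x3 * y1 + (+ 4) * x3 * y2
  z3 = (+ 1) * x0 * y3 + (- (+ 95)) * x1 * y2 + (- (+ 9)) * x1 * y3 + (+ 95) * x2 * y1 + (+ 40) * x2 * y3 + (+ 1) * x3 * y0 + (+ 10) * x3 * y1 + (- (+ 40)) * x3 * y2

scalar : ℤ → Quat
scalar a = ⟨ a , + 0 , + 0 , + 0 ⟩

𝟏 : Quat
𝟏 = scalar (+ 1)

neg : Quat → Quat
neg ⟨ x0 , x1 , x2 , x3 ⟩ = ⟨ - x0 , - x1 , - x2 , - x3 ⟩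

IsUnitℤ : Quat → Set
IsUnitℤ x = Σ[ y ∈ Quat ] (x · y ≡ 𝟏 × y · x ≡ 𝟏)

-- equality in G(Z) = O^× / Z^×, Z^× = {±1}
_~ℤ_ : Quat → Quat → Set
x ~ℤ y = x ≡ y ⊎ x ≡ neg y

infix 4 _≡ℤ[_]_ _≈[_]_ _~[_]_ _~ℤ_
_≡ℤ[_]_ : ℤ → ℕ → ℤ → Set
a ≡ℤ[ m ] b = (+ m) ∣ℤ (a - b)

_≈[_]_ : Quat → ℕ → Quat → Set
x ≈[ m ] y = (c0 x ≡ℤ[ m ] c0 y) × (c1 x ≡ℤ[ m ] c1 y)
           × (c2 x ≡ℤ[ m ] c2 y) × (c3 x ≡ℤ[ m ] c3 y)

IsScalarUnit : ℕ → ℤ → Set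
IsScalarUnit m a = Σ[ b ∈ ℤ ] (a * b ≡ℤ[ m ] + 1)

IsUnit : ℕ → Quat → Set
IsUnit m x = Σ[ y ∈ Quat ] (x · y ≈[ m ] 𝟏 × y · x ≈[ m ] 𝟏)

-- equality in G(Z/mZ) = (O ⊗ Z/mZ)^× / (Z/mZ)^×
_~[_]_ : Quat → ℕ → Quat → Set
x ~[ m ] y = Σ[ a ∈ ℤ ] (IsScalarUnit m a × x ≈[ m ] scalar a · y)

-- H ≤ G(Z/mZ), H given as a predicate on representatives
record IsSubgroup (m : ℕ) (H : Pred Quat 0ℓ) : Set where
  field
    ⊆units   : ∀ {x} → H x → IsUnit m x
    resp     : ∀ {x y} → x ~[ m ] y → H x → H y
    has-one  : H 𝟏
    mul-closed : ∀ {x y} → H x → H y → H (x · y)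
    inv-closed : ∀ {x y} → H x → x · y ≈[ m ] 𝟏 → H y

record IsCongruencePair (m : ℕ) (H : Pred Quat 0ℓ) : Set where
  field
    m-pos     : 0 ℕ.< m
    subgroup  : IsSubgroup m H
    φ-injective : ∀ {x y} → IsUnitℤ x → IsUnitℤ y → x ~[ m ] y → x ~ℤ y
    trivial-∩ : ∀ {x} → IsUnitℤ x → H x → x ~[ m ] 𝟏
    product-all : ∀ {z} → IsUnit m z →
      Σ[ x ∈ Quat ] Σ[ h ∈ Quat ] (IsUnitℤ x × H h × z ~[ m ] x · h)

{-# OPTIONS --safe #-}
module Submission where

open import Defs
open import Data.Nat using (ℕ)
open import Data.Nat.Primality using (Prime)
open import Data.Nat.Divisibility using (_∣_)
open import Data.Product using (Σ-syntax)
open import Relation.Nullary using (¬_)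
open import Relation.Unary using (Pred)
open import Level using (0ℓ)

open import Data.Empty using (⊥; ⊥-elim)
open import Data.Integer as ℤ using (ℤ; +_; -_; -[1+_]; _+_; _-_; _*_)
import Data.Integer.Properties as ℤ
open import Data.Integer.Divisibility.Signed
  using (divides; ∣ᵤ⇒∣; ∣⇒∣ᵤ) renaming (_∣_ to _∣ᵢ_; _∣?_ to _∣ᵢ?_)
import Data.Integer.Tactic.RingSolver as ℤ-Solver
open import Data.Integer.Tactic.RingSolver using (solve-∀)
open import Data.Fin using (#_)
open import Data.List using (List; _∷_; [])
open import Data.List.Membership.Propositional using (_∈_; find)
open import Data.List.Relation.Unary.All as All using (All; all?; _∷_; [])
open import Data.List.Relation.Unary.Any as Any using (Any; any?; here; there)
open import Data.Nat as ℕ using (zero; suc; _≤_; s≤s; s≤s⁻¹; _/_; _%_)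
open import Data.Nat.DivMod using (m≡m%n+[m/n]*n; m%n<n)
open import Data.Nat.Divisibility using (m%n≡0⇒n∣m)
import Data.Nat.Properties as ℕ
import Data.Nat.Tactic.RingSolver as ℕ-Solver
open import Data.Product using (_×_; _,_; ∃-syntax)
open import Data.Product.Properties using (≡-dec)
open import Data.Sum using (inj₁; inj₂)
open import Data.Vec using (Vec; _∷_; [])
open import Function using (_∘_)
open import Relation.Binary using (Setoid; DecidableEquality)
open import Relation.Binary.PropositionalEquality
  using (_≡_; refl; sym; trans; cong; cong₂; subst; module ≡-Reasoning)
import Relation.Binary.Reasoning.Setoid as SetoidReasoning
open import Relation.Nullary using (¬?)
open import Relation.Nullary.Decidable using (map′; _×-dec_; _⊎-dec_; _→-dec_; from-yes)
open import Tactic.RingSolver.Core.Expression using (Expr; Κ; Ι)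
  renaming (_⊕_ to _:+_; _⊗_ to _:*_; ⊝_ to :-_)
open import Tactic.RingSolver.NonReflective ℤ-Solver.ring using (module Ops)

-- If (m, H) were a congruence pair with m odd, 2 would be invertible modulo m, so every
-- element G of reduced norm 2 would be a unit of O/mO.  Writing G = x·h with x ∈ O^× and
-- h ∈ H (up to scalars) puts the translate x⁻¹G into H.  The unit group O^× has only 12
-- elements (in suitable coordinates 4·nrd is a positive definite diagonal form), and a
-- finite search shows that however translates u₀G₀, u₁G₁, u₂G₂ are chosen, two of them
-- multiply to 2t with t ∈ O^× other than ±1.  Then t is a nontrivial element of
-- H ∩ φ_m(G(ℤ)).

infix  4 _≟_
infixl 6 _⊕_
infixr 7 _⋆_

_≟_ : DecidableEquality Quat
⟨ a₀ , a₁ , a₂ , a₃ ⟩ ≟ ⟨ b₀ , b₁ , b₂ , b₃ ⟩ =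
  map′ (λ { (refl , refl , refl , refl) → refl }) (λ { refl → refl , refl , refl , refl })
       (a₀ ℤ.≟ b₀ ×-dec a₁ ℤ.≟ b₁ ×-dec a₂ ℤ.≟ b₂ ×-dec a₃ ℤ.≟ b₃)

_⊕_ : Quat → Quat → Quat
x ⊕ y = ⟨ c0 x + c0 y , c1 x + c1 y , c2 x + c2 y , c3 x + c3 y ⟩

_⋆_ : ℤ → Quat → Quat
a ⋆ x = ⟨ a * c0 x , a * c1 x , a * c2 x , a * c3 x ⟩

conj : Quat → Quat
conj ⟨ a , b , c , d ⟩ = ⟨ a + b , - b , - c , - d ⟩

nrd : Quat → ℤ
nrd ⟨ a , b , c , d ⟩ = a * a + a * b + + 5 * b * b + + 4 * b * d + + 15 * c * c + + 3 * c * d + d * d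

≡-coordinatewise : ∀ {a₀ a₁ a₂ a₃ b₀ b₁ b₂ b₃} → a₀ ≡ b₀ → a₁ ≡ b₁ → a₂ ≡ b₂ → a₃ ≡ b₃ →
                   ⟨ a₀ , a₁ , a₂ , a₃ ⟩ ≡ ⟨ b₀ , b₁ , b₂ , b₃ ⟩
≡-coordinatewise refl refl refl refl = refl

Quatᴱ : ℕ → Set
Quatᴱ n = Expr ℤ n × Expr ℤ n × Expr ℤ n × Expr ℤ n

⟦_⟧ᵠ : ∀ {n} → Quatᴱ n → Vec ℤ n → Quat
⟦ a , b , c , d ⟧ᵠ ρ = ⟨ Ops.⟦ a ⟧ ρ , Ops.⟦ b ⟧ ρ , Ops.⟦ c ⟧ ρ , Ops.⟦ d ⟧ ρ ⟩

NormalFormsAgree : ∀ {n} → Vec ℤ n → Quatᴱ n → Quatᴱ n → Set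
NormalFormsAgree ρ (a , b , c , d) (a′ , b′ , c′ , d′) =
  Ops.⟦ a ⇓⟧ ρ ≡ Ops.⟦ a′ ⇓⟧ ρ × Ops.⟦ b ⇓⟧ ρ ≡ Ops.⟦ b′ ⇓⟧ ρ ×
  Ops.⟦ c ⇓⟧ ρ ≡ Ops.⟦ c′ ⇓⟧ ρ × Ops.⟦ d ⇓⟧ ρ ≡ Ops.⟦ d′ ⇓⟧ ρ

ring-identityᵠ : ∀ {n} (ρ : Vec ℤ n) e e′ → NormalFormsAgree ρ e e′ → ⟦ e ⟧ᵠ ρ ≡ ⟦ e′ ⟧ᵠ ρ
ring-identityᵠ ρ (a , b , c , d) (a′ , b′ , c′ , d′) (a≡a′ , b≡b′ , c≡c′ , d≡d′) =
  ≡-coordinatewise (Ops.prove ρ a a′ a≡a′) (Ops.prove ρ b b′ b≡b′)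
                   (Ops.prove ρ c c′ c≡c′) (Ops.prove ρ d d′ d≡d′)

infixl 6 _⊕ᴱ_
infixl 7 _·ᴱ_
infixr 7 _⋆ᴱ_

-- The multiplication table of _·_, term for term, so that ⟦ x ·ᴱ y ⟧ᵠ unfolds to _·_.
_·ᴱ_ : ∀ {n} → Quatᴱ n → Quatᴱ n → Quatᴱ n
(x0 , x1 , x2 , x3) ·ᴱ (y0 , y1 , y2 , y3) = z0 , z1 , z2 , z3
  where
  z0 = Κ (+ 1) :* x0 :* y0 :+ Κ (- (+ 5)) :* x1 :* y1 :+ Κ (- (+ 20)) :* x1 :* y2 :+ Κ (- (+ 4)) :* x1 :* y3
       :+ Κ (+ 20) :* x2 :* y1 :+ Κ (- (+ 15)) :* x2 :* y2 :+ Κ (+ 7) :* x2 :* y3 :+ Κ (- (+ 10)) :* x3 :* y2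
       :+ Κ (- (+ 1)) :* x3 :* y3
  z1 = Κ (+ 1) :* x0 :* y1 :+ Κ (+ 1) :* x1 :* y0 :+ Κ (+ 1) :* x1 :* y1 :+ Κ (+ 40) :* x1 :* y2
       :+ Κ (+ 4) :* x1 :* y3 :+ Κ (- (+ 40)) :* x2 :* y1 :+ Κ (- (+ 17)) :* x2 :* y3 :+ Κ (- (+ 4)) :* x3 :* y1
       :+ Κ (+ 17) :* x3 :* y2
  z2 = Κ (+ 1) :* x0 :* y2 :+ Κ (+ 10) :* x1 :* y2 :+ Κ (+ 1) :* x1 :* y3 :+ Κ (+ 1) :* x2 :* y0
       :+ Κ (- (+ 9)) :* x2 :* y1 :+ Κ (- (+ 4)) :* x2 :* y3 :+ Κ (- (+ 1)) :* x3 :* y1 :+ Κ (+ 4) :* x3 :* y2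
  z3 = Κ (+ 1) :* x0 :* y3 :+ Κ (- (+ 95)) :* x1 :* y2 :+ Κ (- (+ 9)) :* x1 :* y3 :+ Κ (+ 95) :* x2 :* y1
       :+ Κ (+ 40) :* x2 :* y3 :+ Κ (+ 1) :* x3 :* y0 :+ Κ (+ 10) :* x3 :* y1 :+ Κ (- (+ 40)) :* x3 :* y2

_⊕ᴱ_ : ∀ {n} → Quatᴱ n → Quatᴱ n → Quatᴱ n
(x0 , x1 , x2 , x3) ⊕ᴱ (y0 , y1 , y2 , y3) = x0 :+ y0 , x1 :+ y1 , x2 :+ y2 , x3 :+ y3

_⋆ᴱ_ : ∀ {n} → Expr ℤ n → Quatᴱ n → Quatᴱ n
a ⋆ᴱ (x0 , x1 , x2 , x3) = a :* x0 , a :* x1 , a :* x2 , a :* x3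

negᴱ : ∀ {n} → Quatᴱ n → Quatᴱ n
negᴱ (x0 , x1 , x2 , x3) = :- x0 , :- x1 , :- x2 , :- x3

scalarᴱ : ∀ {n} → Expr ℤ n → Quatᴱ n
scalarᴱ a = a , Κ (+ 0) , Κ (+ 0) , Κ (+ 0)

-- The variables of the identities below: an integer and three quaternions.  Identities in
-- fewer variables fill the spare slots with arbitrary values.
env : ℤ → Quat → Quat → Quat → Vec ℤ 13
env a x y z = a ∷ c0 x ∷ c1 x ∷ c2 x ∷ c3 x ∷ c0 y ∷ c1 y ∷ c2 y ∷ c3 y ∷ c0 z ∷ c1 z ∷ c2 z ∷ c3 z ∷ []

A : Expr ℤ 13
A = Ι (# 0)

X Y Z : Quatᴱ 13
X = Ι (# 1) , Ι (# 2) , Ι (# 3) , Ι (# 4)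
Y = Ι (# 5) , Ι (# 6) , Ι (# 7) , Ι (# 8)
Z = Ι (# 9) , Ι (# 10) , Ι (# 11) , Ι (# 12)

·-assoc : ∀ x y z → (x · y) · z ≡ x · (y · z)
·-assoc x y z = ring-identityᵠ (env (+ 0) x y z) ((X ·ᴱ Y) ·ᴱ Z) (X ·ᴱ (Y ·ᴱ Z)) (refl , refl , refl , refl)

·-identityˡ : ∀ x → 𝟏 · x ≡ x
·-identityˡ x = ring-identityᵠ (env (+ 0) x x x) (scalarᴱ (Κ (+ 1)) ·ᴱ X) X (refl , refl , refl , refl)

·-distribˡ-⊕ : ∀ x y z → x · (y ⊕ z) ≡ x · y ⊕ x · z
·-distribˡ-⊕ x y z =
  ring-identityᵠ (env (+ 0) x y z) (X ·ᴱ (Y ⊕ᴱ Z)) (X ·ᴱ Y ⊕ᴱ X ·ᴱ Z) (refl , refl , refl , refl)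

scalar-· : ∀ a x → scalar a · x ≡ a ⋆ x
scalar-· a x = ring-identityᵠ (env a x x x) (scalarᴱ A ·ᴱ X) (A ⋆ᴱ X) (refl , refl , refl , refl)

⋆-·-assoc : ∀ a x y → (a ⋆ x) · y ≡ a ⋆ (x · y)
⋆-·-assoc a x y = ring-identityᵠ (env a x y y) ((A ⋆ᴱ X) ·ᴱ Y) (A ⋆ᴱ (X ·ᴱ Y)) (refl , refl , refl , refl)

·-⋆-comm : ∀ x a y → x · (a ⋆ y) ≡ a ⋆ (x · y)
·-⋆-comm x a y = ring-identityᵠ (env a x y y) (X ·ᴱ (A ⋆ᴱ Y)) (A ⋆ᴱ (X ·ᴱ Y)) (refl , refl , refl , refl)

⋆-assoc : ∀ a b x → (a * b) ⋆ x ≡ a ⋆ (b ⋆ x)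
⋆-assoc a b x = ≡-coordinatewise
  (ℤ.*-assoc a b (c0 x)) (ℤ.*-assoc a b (c1 x)) (ℤ.*-assoc a b (c2 x)) (ℤ.*-assoc a b (c3 x))

nrdᴱ : ∀ {n} → Quatᴱ n → Expr ℤ n
nrdᴱ (a , b , c , d) =
  a :* a :+ a :* b :+ Κ (+ 5) :* b :* b :+ Κ (+ 4) :* b :* d :+ Κ (+ 15) :* c :* c :+ Κ (+ 3) :* c :* d :+ d :* d

nrd-· : ∀ x y → nrd (x · y) ≡ nrd x * nrd y
nrd-· x y = Ops.prove (env (+ 0) x y y) (nrdᴱ (X ·ᴱ Y)) (nrdᴱ X :* nrdᴱ Y) refl

-- Congruences modulo m

module _ {m : ℕ} where

  ≡ℤ-intro : ∀ {a b} q → a ≡ b + + m * q → a ≡ℤ[ m ] b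
  ≡ℤ-intro {b = b} q refl = ∣⇒∣ᵤ (divides q (lemma b (+ m) q))
    where
    lemma : ∀ b n q → b + n * q - b ≡ q * n
    lemma = solve-∀

  ≡ℤ-elim : ∀ {a b} → a ≡ℤ[ m ] b → ∃[ q ] a ≡ b + + m * q
  ≡ℤ-elim {a} {b} a≡b with ∣ᵤ⇒∣ a≡b
  ... | divides q a-b≡qm = q , (begin
    a            ≡⟨ lemma a b ⟩
    b + (a - b)  ≡⟨ cong (_+_ b) a-b≡qm ⟩
    b + q * + m  ≡⟨ cong (_+_ b) (ℤ.*-comm q (+ m)) ⟩
    b + + m * q  ∎)
    where
    open ≡-Reasoning
    lemma : ∀ a b → a ≡ b + (a - b)
    lemma = solve-∀

  ≈-intro : ∀ {x y} k → x ≡ y ⊕ + m ⋆ k → x ≈[ m ] y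
  ≈-intro k x≡y+mk =
    ≡ℤ-intro (c0 k) (cong c0 x≡y+mk) , ≡ℤ-intro (c1 k) (cong c1 x≡y+mk) ,
    ≡ℤ-intro (c2 k) (cong c2 x≡y+mk) , ≡ℤ-intro (c3 k) (cong c3 x≡y+mk)

  ≈-elim : ∀ {x y} → x ≈[ m ] y → ∃[ k ] x ≡ y ⊕ + m ⋆ k
  ≈-elim (e₀ , e₁ , e₂ , e₃) with ≡ℤ-elim e₀ | ≡ℤ-elim e₁ | ≡ℤ-elim e₂ | ≡ℤ-elim e₃
  ... | q₀ , p₀ | q₁ , p₁ | q₂ , p₂ | q₃ , p₃ = ⟨ q₀ , q₁ , q₂ , q₃ ⟩ , ≡-coordinatewise p₀ p₁ p₂ p₃

  ≈-reflexive : ∀ {x y} → x ≡ y → x ≈[ m ] y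
  ≈-reflexive {y = y} refl = ≈-intro (scalar (+ 0)) (lemma y (+ m))
    where
    lemma : ∀ y n → y ≡ y ⊕ n ⋆ scalar (+ 0)
    lemma y n = ring-identityᵠ (env n y y y) X (X ⊕ᴱ A ⋆ᴱ scalarᴱ (Κ (+ 0))) (refl , refl , refl , refl)

  ≈-sym : ∀ {x y} → x ≈[ m ] y → y ≈[ m ] x
  ≈-sym {x} {y} x≈y with ≈-elim {x} {y} x≈y
  ... | k , x≡y+mk = ≈-intro (neg k) (begin
    y                            ≡⟨ lemma y (+ m) k ⟩
    (y ⊕ + m ⋆ k) ⊕ + m ⋆ neg k  ≡⟨ cong (_⊕ + m ⋆ neg k) x≡y+mk ⟨
    x ⊕ + m ⋆ neg k              ∎)
    where
    open ≡-Reasoning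
    lemma : ∀ y n k → y ≡ (y ⊕ n ⋆ k) ⊕ n ⋆ neg k
    lemma y n k = ring-identityᵠ (env n y k k) X ((X ⊕ᴱ A ⋆ᴱ Y) ⊕ᴱ A ⋆ᴱ negᴱ Y) (refl , refl , refl , refl)

  ≈-trans : ∀ {x y z} → x ≈[ m ] y → y ≈[ m ] z → x ≈[ m ] z
  ≈-trans {x} {y} {z} x≈y y≈z with ≈-elim {x} {y} x≈y | ≈-elim {y} {z} y≈z
  ... | k , x≡y+mk | l , y≡z+ml = ≈-intro (l ⊕ k) (begin
    x                        ≡⟨ x≡y+mk ⟩
    y ⊕ + m ⋆ k              ≡⟨ cong (_⊕ + m ⋆ k) y≡z+ml ⟩
    (z ⊕ + m ⋆ l) ⊕ + m ⋆ k  ≡⟨ lemma z (+ m) k l ⟩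
    z ⊕ + m ⋆ (l ⊕ k)        ∎)
    where
    open ≡-Reasoning
    lemma : ∀ z n k l → (z ⊕ n ⋆ l) ⊕ n ⋆ k ≡ z ⊕ n ⋆ (l ⊕ k)
    lemma z n k l =
      ring-identityᵠ (env n z k l) ((X ⊕ᴱ A ⋆ᴱ Z) ⊕ᴱ A ⋆ᴱ Y) (X ⊕ᴱ A ⋆ᴱ (Z ⊕ᴱ Y)) (refl , refl , refl , refl)

  ≈-setoid : Setoid 0ℓ 0ℓ
  ≈-setoid = record
    { Carrier       = Quat
    ; _≈_           = _≈[ m ]_
    ; isEquivalence = record
      { refl  = λ {x} → ≈-reflexive {x} refl
      ; sym   = λ {x} {y} → ≈-sym {x} {y}
      ; trans = λ {x} {y} {z} → ≈-trans {x} {y} {z}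
      }
    }

  ·-congˡ : ∀ z {x y} → x ≈[ m ] y → z · x ≈[ m ] z · y
  ·-congˡ z {x} {y} x≈y with ≈-elim {x} {y} x≈y
  ... | k , x≡y+mk = ≈-intro (z · k) (begin
    z · x                  ≡⟨ cong (z ·_) x≡y+mk ⟩
    z · (y ⊕ + m ⋆ k)      ≡⟨ ·-distribˡ-⊕ z y (+ m ⋆ k) ⟩
    z · y ⊕ z · (+ m ⋆ k)  ≡⟨ cong (_⊕_ (z · y)) (·-⋆-comm z (+ m) k) ⟩
    z · y ⊕ + m ⋆ (z · k)  ∎)
    where open ≡-Reasoning

  ⋆-≈ : ∀ {a} x → a ≡ℤ[ m ] + 1 → a ⋆ x ≈[ m ] x
  ⋆-≈ {a} x a≡1 with ≡ℤ-elim {a} {+ 1} a≡1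
  ... | q , refl = ≈-intro (q ⋆ x) (begin
    (+ 1 + + m * q) ⋆ x  ≡⟨ lemma (+ m * q) x ⟩
    x ⊕ (+ m * q) ⋆ x    ≡⟨ cong (_⊕_ x) (⋆-assoc (+ m) q x) ⟩
    x ⊕ + m ⋆ (q ⋆ x)    ∎)
    where
    open ≡-Reasoning
    lemma : ∀ c x → (+ 1 + c) ⋆ x ≡ x ⊕ c ⋆ x
    lemma c x = ring-identityᵠ (env c x x x) ((Κ (+ 1) :+ A) ⋆ᴱ X) (X ⊕ᴱ A ⋆ᴱ X) (refl , refl , refl , refl)

  scalarUnit-comm : ∀ {a b} → a * b ≡ℤ[ m ] + 1 → b * a ≡ℤ[ m ] + 1
  scalarUnit-comm {a} {b} = subst (_≡ℤ[ m ] + 1) (ℤ.*-comm a b)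

  ~-transpose : ∀ {g x y h} → y · x ≡ 𝟏 → g ~[ m ] x · h → h ~[ m ] y · g
  ~-transpose {g} {x} {y} {h} y·x≡𝟏 (a , (b , ab≡1) , g≈a[xh]) =
    b , (a , scalarUnit-comm {a} {b} ab≡1) , ≈-sym {scalar b · (y · g)} {h} (begin
    scalar b · (y · g)                     ≈⟨ ·-congˡ (scalar b) (·-congˡ y g≈a[xh]) ⟩
    scalar b · (y · (scalar a · (x · h)))  ≡⟨ cong (λ w → scalar b · (y · w)) (scalar-· a (x · h)) ⟩
    scalar b · (y · (a ⋆ (x · h)))         ≡⟨ scalar-· b _ ⟩
    b ⋆ (y · (a ⋆ (x · h)))                ≡⟨ cong (b ⋆_) (·-⋆-comm y a (x · h)) ⟩
    b ⋆ (a ⋆ (y · (x · h)))                ≡⟨ ⋆-assoc b a _ ⟨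
    (b * a) ⋆ (y · (x · h))                ≡⟨ cong ((b * a) ⋆_) (·-assoc y x h) ⟨
    (b * a) ⋆ ((y · x) · h)                ≡⟨ cong (λ w → (b * a) ⋆ (w · h)) y·x≡𝟏 ⟩
    (b * a) ⋆ (𝟏 · h)                      ≡⟨ cong ((b * a) ⋆_) (·-identityˡ h) ⟩
    (b * a) ⋆ h                            ≈⟨ ⋆-≈ {b * a} h (scalarUnit-comm {a} {b} ab≡1) ⟩
    h                                      ∎)
    where open SetoidReasoning (≈-setoid)

  unit-mod-of-scalar-norm : ∀ {c} x y → IsScalarUnit m c → x · y ≡ c ⋆ 𝟏 → y · x ≡ c ⋆ 𝟏 → IsUnit m x
  unit-mod-of-scalar-norm {c} x y (b , cb≡1) x·y≡c y·x≡c = b ⋆ y , right , left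
    where
    to-𝟏 : ∀ {w} → w ≡ b ⋆ (c ⋆ 𝟏) → w ≈[ m ] 𝟏
    to-𝟏 {w} w≡bc = ≈-trans {w} {(b * c) ⋆ 𝟏} {𝟏}
      (≈-reflexive (trans w≡bc (sym (⋆-assoc b c 𝟏)))) (⋆-≈ {b * c} 𝟏 (scalarUnit-comm {c} {b} cb≡1))
    right : x · (b ⋆ y) ≈[ m ] 𝟏
    right = to-𝟏 (trans (·-⋆-comm x b y) (cong (b ⋆_) x·y≡c))
    left : (b ⋆ y) · x ≈[ m ] 𝟏
    left  = to-𝟏 (trans (⋆-·-assoc b y x) (cong (b ⋆_) y·x≡c))

-- The unit group of O

units : List Quat
units =
  ⟨ - + 2 , + 4 , + 1 , - + 10 ⟩ ∷ ⟨ - + 2 , + 4 , + 1 , - + 9 ⟩ ∷ ⟨ - + 1 , + 0 , + 0 , + 0 ⟩ ∷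
  ⟨ - + 1 , + 1 , + 0 , - + 2 ⟩ ∷ ⟨ + 0 , - + 1 , + 0 , + 2 ⟩ ∷ ⟨ + 0 , + 0 , + 0 , - + 1 ⟩ ∷
  ⟨ + 0 , + 0 , + 0 , + 1 ⟩ ∷ ⟨ + 0 , + 1 , + 0 , - + 2 ⟩ ∷ ⟨ + 1 , - + 1 , + 0 , + 2 ⟩ ∷
  ⟨ + 1 , + 0 , + 0 , + 0 ⟩ ∷ ⟨ + 2 , - + 4 , - + 1 , + 9 ⟩ ∷ ⟨ + 2 , - + 4 , - + 1 , + 10 ⟩ ∷ []

units-invertible : All IsUnitℤ units
units-invertible = All.map (λ {u} (u·ū≡𝟏 , ū·u≡𝟏) → conj u , u·ū≡𝟏 , ū·u≡𝟏)
  (from-yes (all? (λ u → (u · conj u ≟ 𝟏) ×-dec (conj u · u ≟ 𝟏)) units))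

ℤ⁴ : Set
ℤ⁴ = ℤ × ℤ × ℤ × ℤ

diagonal : Quat → ℤ⁴
diagonal ⟨ a , b , c , d ⟩ = + 2 * a + b , + 2 * d + + 4 * b + + 3 * c , b - + 4 * c , c

undiagonal : ℤ⁴ → Quat
undiagonal (s , t , u , v) = ⟨ s - u - + 4 * v , + 2 * u + + 8 * v , + 2 * v , t - + 4 * u - + 19 * v ⟩

sq : ℤ → ℕ
sq z = ℤ.∣ z ∣ ℕ.* ℤ.∣ z ∣

form : ℤ⁴ → ℕ
form (s , t , u , v) = sq s ℕ.+ sq t ℕ.+ 3 ℕ.* sq u ℕ.+ 3 ℕ.* sq v

*-self≡sq : ∀ z → z * z ≡ + sq z
*-self≡sq (+ n)    = sym (ℤ.pos-* n n)
*-self≡sq -[1+ n ] = refl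

four*nrd≡form : ∀ x → + 4 * nrd x ≡ + form (diagonal x)
four*nrd≡form ⟨ a , b , c , d ⟩ =
  trans (diagonalise a b c d) (squares (+ 2 * a + b) (+ 2 * d + + 4 * b + + 3 * c) (b - + 4 * c) c)
  where
  diagonalise : ∀ a b c d →
    + 4 * (a * a + a * b + + 5 * b * b + + 4 * b * d + + 15 * c * c + + 3 * c * d + d * d) ≡
    (+ 2 * a + b) * (+ 2 * a + b) + (+ 2 * d + + 4 * b + + 3 * c) * (+ 2 * d + + 4 * b + + 3 * c)
    + + 3 * ((b - + 4 * c) * (b - + 4 * c)) + + 3 * (c * c)
  diagonalise = solve-∀
  squares : ∀ s t u v → s * s + t * t + + 3 * (u * u) + + 3 * (v * v) ≡ + form (s , t , u , v)
  squares s t u v rewrite *-self≡sq s | *-self≡sq t | *-self≡sq u | *-self≡sq v =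
    cong₂ _+_ (cong (_+_ (+ (sq s ℕ.+ sq t))) (sym (ℤ.pos-* 3 (sq u)))) (sym (ℤ.pos-* 3 (sq v)))

double≡undiagonal : ∀ x → + 2 ⋆ x ≡ undiagonal (diagonal x)
double≡undiagonal ⟨ a , b , c , d ⟩ = ≡-coordinatewise (first a b c) (second b c) refl (fourth b c d)
  where
  first : ∀ a b c → + 2 * a ≡ (+ 2 * a + b) - (b - + 4 * c) - + 4 * c
  first = solve-∀
  second : ∀ b c → + 2 * b ≡ + 2 * (b - + 4 * c) + + 8 * c
  second = solve-∀
  fourth : ∀ b c d → + 2 * d ≡ (+ 2 * d + + 4 * b + + 3 * c) - + 4 * (b - + 4 * c) - + 19 * c
  fourth = solve-∀

⋆-cancelˡ : ∀ a .{{_ : ℤ.NonZero a}} {x y} → a ⋆ x ≡ a ⋆ y → x ≡ y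
⋆-cancelˡ a eq = ≡-coordinatewise
  (ℤ.*-cancelˡ-≡ a _ _ (cong c0 eq)) (ℤ.*-cancelˡ-≡ a _ _ (cong c1 eq))
  (ℤ.*-cancelˡ-≡ a _ _ (cong c2 eq)) (ℤ.*-cancelˡ-≡ a _ _ (cong c3 eq))

diagonal-injective : ∀ {x y} → diagonal x ≡ diagonal y → x ≡ y
diagonal-injective {x} {y} eq = ⋆-cancelˡ (+ 2) (begin
  + 2 ⋆ x                  ≡⟨ double≡undiagonal x ⟩
  undiagonal (diagonal x)  ≡⟨ cong undiagonal eq ⟩
  undiagonal (diagonal y)  ≡⟨ double≡undiagonal y ⟨
  + 2 ⋆ y                  ∎)
  where open ≡-Reasoning

unit⇒∣nrd∣≡1 : ∀ {x} → IsUnitℤ x → ℤ.∣ nrd x ∣ ≡ 1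
unit⇒∣nrd∣≡1 {x} (y , x·y≡𝟏 , _) = ℕ.m*n≡1⇒m≡1 ℤ.∣ nrd x ∣ ℤ.∣ nrd y ∣ (begin
  ℤ.∣ nrd x ∣ ℕ.* ℤ.∣ nrd y ∣  ≡⟨ ℤ.abs-* (nrd x) (nrd y) ⟨
  ℤ.∣ nrd x * nrd y ∣          ≡⟨ cong ℤ.∣_∣ (nrd-· x y) ⟨
  ℤ.∣ nrd (x · y) ∣            ≡⟨ cong (ℤ.∣_∣ ∘ nrd) x·y≡𝟏 ⟩
  1                            ∎)
  where open ≡-Reasoning

unit⇒form≡4 : ∀ {x} → IsUnitℤ x → form (diagonal x) ≡ 4
unit⇒form≡4 {x} x-unit = begin
  form (diagonal x)    ≡⟨ cong ℤ.∣_∣ (four*nrd≡form x) ⟨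
  ℤ.∣ + 4 * nrd x ∣    ≡⟨ ℤ.abs-* (+ 4) (nrd x) ⟩
  4 ℕ.* ℤ.∣ nrd x ∣    ≡⟨ cong (4 ℕ.*_) (unit⇒∣nrd∣≡1 x-unit) ⟩
  4                    ∎
  where open ≡-Reasoning

interval : ℕ → List ℤ
interval zero    = + 0 ∷ []
interval (suc n) = - + suc n ∷ + suc n ∷ interval n

∣∣≤⇒∈interval : ∀ n z → ℤ.∣ z ∣ ≤ n → z ∈ interval n
∣∣≤⇒∈interval zero    (+ zero) _ = here refl
∣∣≤⇒∈interval (suc n) z ∣z∣≤1+n with ℕ.m≤n⇒m<n∨m≡n ∣z∣≤1+n
... | inj₁ ∣z∣<1+n = there (there (∣∣≤⇒∈interval n z (s≤s⁻¹ ∣z∣<1+n)))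
∣∣≤⇒∈interval (suc n) (+ _)    _ | inj₂ refl = there (here refl)
∣∣≤⇒∈interval (suc n) -[1+ _ ] _ | inj₂ refl = here refl

m*m≤n*n⇒m≤n : ∀ {m n} → m ℕ.* m ≤ n ℕ.* n → m ≤ n
m*m≤n*n⇒m≤n m*m≤n*n = ℕ.≮⇒≥ (λ n<m → ℕ.<⇒≱ (ℕ.*-mono-< n<m n<m) m*m≤n*n)

sq≤4⇒∈interval : ∀ z → sq z ≤ 4 → z ∈ interval 2
sq≤4⇒∈interval z sq≤4 = ∣∣≤⇒∈interval 2 z (m*m≤n*n⇒m≤n sq≤4)

form≡4⇒∈box : ∀ {s t u v} → form (s , t , u , v) ≡ 4 →
              s ∈ interval 2 × t ∈ interval 2 × u ∈ interval 2 × v ∈ interval 2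
form≡4⇒∈box {s} {t} {u} {v} form≡4 =
  sq≤4⇒∈interval s (≤4 (ℕ.≤-trans (ℕ.m≤m+n (sq s) (sq t)) first-two)) ,
  sq≤4⇒∈interval t (≤4 (ℕ.≤-trans (ℕ.m≤n+m (sq t) (sq s)) first-two)) ,
  sq≤4⇒∈interval u (≤4 (ℕ.≤-trans (ℕ.m≤n*m (sq u) 3)
    (ℕ.≤-trans (ℕ.m≤n+m _ (sq s ℕ.+ sq t)) (ℕ.m≤m+n _ (3 ℕ.* sq v))))) ,
  sq≤4⇒∈interval v (≤4 (ℕ.≤-trans (ℕ.m≤n*m (sq v) 3) (ℕ.m≤n+m _ (sq s ℕ.+ sq t ℕ.+ 3 ℕ.* sq u))))
  where
  ≤4 : ∀ {k} → k ≤ form (s , t , u , v) → k ≤ 4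
  ≤4 {k} = subst (k ≤_) form≡4
  first-two : sq s ℕ.+ sq t ≤ form (s , t , u , v)
  first-two = ℕ.≤-trans (ℕ.m≤m+n _ (3 ℕ.* sq u)) (ℕ.m≤m+n _ (3 ℕ.* sq v))

Even : Quat → Set
Even q = + 2 ∣ᵢ c0 q × + 2 ∣ᵢ c1 q × + 2 ∣ᵢ c2 q × + 2 ∣ᵢ c3 q

double-even : ∀ x → Even (+ 2 ⋆ x)
double-even x =
  divides (c0 x) (ℤ.*-comm (+ 2) (c0 x)) , divides (c1 x) (ℤ.*-comm (+ 2) (c1 x)) ,
  divides (c2 x) (ℤ.*-comm (+ 2) (c2 x)) , divides (c3 x) (ℤ.*-comm (+ 2) (c3 x))

-- diagonal has image of index 4 in ℤ⁴; for w = diagonal x, undiagonal w = 2x is even.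
box-check : All (λ s → All (λ t → All (λ u → All (λ v →
              form (s , t , u , v) ≡ 4 → Even (undiagonal (s , t , u , v)) →
              Any (λ x → diagonal x ≡ (s , t , u , v)) units)
            (interval 2)) (interval 2)) (interval 2)) (interval 2)
box-check = from-yes (all? (λ s → all? (λ t → all? (λ u → all? (λ v →
  form (s , t , u , v) ℕ.≟ 4 →-dec even? (undiagonal (s , t , u , v)) →-dec
  any? (λ x → diagonal x ≟⁴ (s , t , u , v)) units)
  (interval 2)) (interval 2)) (interval 2)) (interval 2))
  where
  even? : ∀ q → _
  even? q = + 2 ∣ᵢ? c0 q ×-dec + 2 ∣ᵢ? c1 q ×-dec + 2 ∣ᵢ? c2 q ×-dec + 2 ∣ᵢ? c3 q
  _≟⁴_ : DecidableEquality ℤ⁴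
  _≟⁴_ = ≡-dec ℤ._≟_ (≡-dec ℤ._≟_ (≡-dec ℤ._≟_ ℤ._≟_))

unit∈units : ∀ {x} → IsUnitℤ x → x ∈ units
unit∈units {x} x-unit with form≡4⇒∈box (unit⇒form≡4 x-unit)
... | s∈ , t∈ , u∈ , v∈ =
  Any.map (λ eq → diagonal-injective (sym eq))
    (All.lookup (All.lookup (All.lookup (All.lookup box-check s∈) t∈) u∈) v∈
      (unit⇒form≡4 x-unit) (subst Even (double≡undiagonal x) (double-even x)))

-- Elements of reduced norm 2

-- G₀, G₁, G₂ represent the three orbits of O^× acting by left multiplication
-- on the 36 elements of reduced norm 2.
G₀ G₁ G₂ : Quat
G₀ = ⟨ + 0 , + 1 , + 0 , - + 1 ⟩
G₁ = ⟨ + 1 , - + 1 , + 0 , + 1 ⟩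
G₂ = ⟨ + 1 , + 0 , + 0 , + 1 ⟩

TwiceNontrivialUnit : Quat → Set
TwiceNontrivialUnit q = Any (λ t → q ≡ scalar (+ 2) · t × ¬ t ~ℤ 𝟏) units

Collision : List Quat → Set
Collision hs = Any (λ g → Any (λ g′ → TwiceNontrivialUnit (g · g′)) hs) hs

collision-check : All (λ u₀ → All (λ u₁ → All (λ u₂ →
                    Collision (u₀ · G₀ ∷ u₁ · G₁ ∷ u₂ · G₂ ∷ []))
                  units) units) units
collision-check = from-yes (all? (λ u₀ → all? (λ u₁ → all? (λ u₂ →
  collision? (u₀ · G₀ ∷ u₁ · G₁ ∷ u₂ · G₂ ∷ []))
  units) units) units)
  where
  collision? : ∀ hs → _
  collision? hs = any? (λ g → any? (λ g′ → any? (λ t →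
    (g · g′ ≟ scalar (+ 2) · t) ×-dec ¬? ((t ≟ 𝟏) ⊎-dec (t ≟ neg 𝟏))) units) hs) hs

-- No congruence pair modulo an odd number

module _ {m : ℕ} {H : Pred Quat 0ℓ} (cp : IsCongruencePair m H) where
  TranslateInH : Quat → Set
  TranslateInH g = ∃[ u ] u ∈ units × H (u · g)

  open IsCongruencePair cp
  open IsSubgroup subgroup

  unit-translate∈H : ∀ {g} → IsUnit m g → TranslateInH g
  unit-translate∈H {g} g-unit with product-all {g} g-unit
  ... | x , h , (y , x·y≡𝟏 , y·x≡𝟏) , h∈H , g~xh =
    y , unit∈units {y} (x , y·x≡𝟏 , x·y≡𝟏) ,
    resp {h} {y · g} (~-transpose {g = g} {x} {y} {h} y·x≡𝟏 g~xh) h∈H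

  norm-two-translate∈H : IsScalarUnit m (+ 2) → ∀ G → G · conj G ≡ + 2 ⋆ 𝟏 → conj G · G ≡ + 2 ⋆ 𝟏 →
                         TranslateInH G
  norm-two-translate∈H 2-unit G GḠ≡2 ḠG≡2 =
    unit-translate∈H {G} (unit-mod-of-scalar-norm {m} {+ 2} G (conj G) 2-unit GḠ≡2 ḠG≡2)

  no-collision : IsScalarUnit m (+ 2) → ∀ {hs} → All H hs → ¬ Collision hs
  no-collision 2-unit hs⊆H collision with find collision
  ... | g , g∈hs , collision′ with find collision′
  ... | g′ , g′∈hs , twice with find twice
  ... | t , t∈units , gg′≡2t , t≁𝟏 =
    t≁𝟏 (φ-injective {t} {𝟏} t-unit (𝟏 , refl , refl) (trivial-∩ {t} t-unit t∈H))
    where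
    t-unit : IsUnitℤ t
    t-unit = All.lookup units-invertible t∈units
    t∈H : H t
    t∈H = resp {g · g′} {t} (+ 2 , 2-unit , ≈-reflexive {x = g · g′} {scalar (+ 2) · t} gg′≡2t)
               (mul-closed {g} {g′} (All.lookup hs⊆H g∈hs) (All.lookup hs⊆H g′∈hs))

  translates⇒⊥ : IsScalarUnit m (+ 2) → TranslateInH G₀ → TranslateInH G₁ → TranslateInH G₂ → ⊥
  translates⇒⊥ 2-unit (u₀ , u₀∈ , h₀) (u₁ , u₁∈ , h₁) (u₂ , u₂∈ , h₂) =
    no-collision 2-unit (h₀ ∷ h₁ ∷ h₂ ∷ [])
      (All.lookup (All.lookup (All.lookup collision-check u₀∈) u₁∈) u₂∈)

no-congruence-pair : ∀ {m H} → IsScalarUnit m (+ 2) → ¬ IsCongruencePair m H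
no-congruence-pair 2-unit cp = translates⇒⊥ cp 2-unit
  (norm-two-translate∈H cp 2-unit G₀ refl refl)
  (norm-two-translate∈H cp 2-unit G₁ refl refl)
  (norm-two-translate∈H cp 2-unit G₂ refl refl)

odd⇒≡1+[m/2]*2 : ∀ {m} → ¬ 2 ∣ m → m ≡ suc (m / 2 ℕ.* 2)
odd⇒≡1+[m/2]*2 {m} 2∤m = trans (m≡m%n+[m/n]*n m 2) (cong (ℕ._+ m / 2 ℕ.* 2) m%2≡1)
  where
  m%2≡1 : m % 2 ≡ 1
  m%2≡1 with m % 2 | m%n<n m 2 | 2∤m ∘ m%n≡0⇒n∣m m 2
  ... | 0           | _            | m%2≢0 = ⊥-elim (m%2≢0 refl)
  ... | 1           | _            | _     = refl
  ... | suc (suc _) | s≤s (s≤s ()) | _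

2-invertible-mod-1+2q : ∀ q → IsScalarUnit (suc (q ℕ.* 2)) (+ 2)
2-invertible-mod-1+2q q = + suc q , ≡ℤ-intro {m = suc (q ℕ.* 2)} {b = + 1} (+ 1) (begin
  + 2 * + suc q                  ≡⟨ ℤ.pos-* 2 (suc q) ⟨
  + (2 ℕ.* suc q)                ≡⟨ cong +_ (lemma q) ⟩
  + (1 ℕ.+ suc (q ℕ.* 2) ℕ.* 1)  ≡⟨ cong (_+_ (+ 1)) (ℤ.pos-* (suc (q ℕ.* 2)) 1) ⟩
  + 1 + + suc (q ℕ.* 2) * + 1    ∎)
  where
  open ≡-Reasoning
  lemma : ∀ q → 2 ℕ.* suc q ≡ 1 ℕ.+ suc (q ℕ.* 2) ℕ.* 1
  lemma = ℕ-Solver.solve-∀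

odd⇒2-invertible : ∀ {m} → ¬ 2 ∣ m → IsScalarUnit m (+ 2)
odd⇒2-invertible {m} 2∤m =
  subst (λ n → IsScalarUnit n (+ 2)) (sym (odd⇒≡1+[m/2]*2 2∤m)) (2-invertible-mod-1+2q (m / 2))

proposition6p3 : (p : ℕ) → Prime p → ¬ (2 ∣ p) →
    ¬ (Σ[ H ∈ Pred Quat 0ℓ ] IsCongruencePair p H)
proposition6p3 p _ 2∤p (H , cp) = no-congruence-pair (odd⇒2-invertible 2∤p) cp
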